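{- For all integers $m\ge 0$ and $n\ge 1$, writing $U_k=T_{k}^{(s_{1,0}^{(n)},s_{1,1}^{(n)},s_{1,2}^{(n)})}$ and $V^{(j)}_k=T_{k}^{(s_{1,0}^{(jn)},s_{1,1}^{(jn)},s_{1,2}^{(jn)})}$ for $j=2,3,4$, \begin{align*} \frac{1}{(A_1^{(n)})^4}\sum_{\substack{k_1+k_2+k_3+k_4=m\\ k_1,k_2,k_3,k_4\ge 0}}\binom{m}{k_1,k_2,k_3,k_4}U_{k_1}U_{k_2}U_{k_3}U_{k_4} &=-\frac{6\cdot 4^m}{A_1^{(4n)}}V^{(4)}_m +\frac{4}{A_1^{(3n)} A_1^{(n)}}\sum_{k=0}^m\binom{m}{k}3^{k}V^{(3)}_k U_{m-k}\\ &\quad +\frac{3}{(A_1^{(2n)})^2}\sum_{k=0}^m\binom{m}{k}2^{m}V^{(2)}_kV^{(2)}_{m-k} +\frac{12}{44^nA_1^{(n)}}\sum_{k=0}^m\binom{m}{k}U_k. \end{align*}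
   Context: Let $\alpha,\beta,\gamma$ be the three distinct complex roots of $x^3-x^2-x-1=0$, and set $c_1=\frac{\alpha}{(\alpha-\beta)(\alpha-\gamma)}$, $c_2=\frac{\beta}{(\beta-\alpha)(\beta-\gamma)}$, $c_3=\frac{\gamma}{(\gamma-\alpha)(\gamma-\beta)}$. For numbers $s_0,s_1,s_2$, the sequence $T_k^{(s_0,s_1,s_2)}$ is defined by $T_0^{(s_0,s_1,s_2)}=s_0$, $T_1^{(s_0,s_1,s_2)}=s_1$, $T_2^{(s_0,s_1,s_2)}=s_2$ and $T_k^{(s_0,s_1,s_2)}=T_{k-1}^{(s_0,s_1,s_2)}+T_{k-2}^{(s_0,s_1,s_2)}+T_{k-3}^{(s_0,s_1,s_2)}$ for $k\ge3$. For each integer $N\ge1$, let $A_1^{(N)}\neq0$ and $s_{1,0}^{(N)},s_{1,1}^{(N)},s_{1,2}^{(N)}$ be numbers such that $c_1^Ne^{\alpha x}+c_2^Ne^{\beta x}+c_3^Ne^{\gamma x}=\frac{1}{A_1^{(N)}}\sum_{k\ge0}T_k^{(s_{1,0}^{(N)},s_{1,1}^{(N)},s_{1,2}^{(N)})}\frac{x^k}{k!}$ (in the paper these are specific integer normalizations). $\binom{m}{k_1,\dots,k_r}=\frac{m!}{k_1!\cdots k_r!}$ is the multinomial coefficient. -}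

module Defs where

open import Level using (_⊔_) renaming (suc to lsuc)
open import Data.Nat.Base as ℕ using (ℕ; zero; suc; _∸_; NonZero; _!)
open import Data.Nat.Properties using (_!≢0; m*n≢0)
open import Data.Nat.DivMod using (_/_)
open import Data.Nat.Combinatorics using (_C_)
open import Algebra.Bundles using (CommutativeRing; Semiring)
import Algebra.Definitions.RawSemiring as RS
open import Relation.Binary.PropositionalEquality using (_≡_)
open import Relation.Nullary using (¬_)

-- A field of characteristic 0, presented as a commutative ring together with
-- a (total) inverse operation that is a genuine inverse on nonzero elements.
-- (The complex numbers are the intended instance.)
record Char0Field c ℓ : Set (lsuc (c ⊔ ℓ)) where
  field
    commRing : CommutativeRing c ℓ
  open CommutativeRing commRing public
  open RS (Semiring.rawSemiring semiring) public using (_×_; _^_)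
  field
    _⁻¹       : Carrier → Carrier
    ⁻¹-inverse : ∀ x → ¬ (x ≈ 0#) → x * (x ⁻¹) ≈ 1#
    char0     : ∀ n → n × 1# ≈ 0# → n ≡ 0

  infixl 6 _−_
  infixl 7 _÷_
  _−_ : Carrier → Carrier → Carrier
  x − y = x + (- y)

  _÷_ : Carrier → Carrier → Carrier
  x ÷ y = x * (y ⁻¹)

  ⟦_⟧ : ℕ → Carrier
  ⟦ k ⟧ = k × 1#

  sumTo : ℕ → (ℕ → Carrier) → Carrier
  sumTo zero    f = f 0
  sumTo (suc m) f = sumTo m f + f (suc m)

  T : Carrier → Carrier → Carrier → ℕ → Carrier
  T s0 s1 s2 0 = s0
  T s0 s1 s2 1 = s1
  T s0 s1 s2 2 = s2
  T s0 s1 s2 (suc (suc (suc k))) =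
    T s0 s1 s2 (suc (suc k)) + T s0 s1 s2 (suc k) + T s0 s1 s2 k

multinomial4 : ℕ → ℕ → ℕ → ℕ → ℕ → ℕ
multinomial4 m k₁ k₂ k₃ k₄ =
  (m ! / (k₁ ! ℕ.* k₂ ! ℕ.* k₃ ! ℕ.* k₄ !))
    {{m*n≢0 (k₁ ! ℕ.* k₂ ! ℕ.* k₃ !) (k₄ !)
       {{m*n≢0 (k₁ ! ℕ.* k₂ !) (k₃ !) {{m*n≢0 (k₁ !) (k₂ !) {{k₁ !≢0}} {{k₂ !≢0}}}} {{k₃ !≢0}}}}
       {{k₄ !≢0}}}}

module Tribonacci {c ℓ} (F : Char0Field c ℓ) (α β γ : Char0Field.Carrier F) where
  open Char0Field F

  c₁ c₂ c₃ : Carrier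
  c₁ = α ÷ ((α − β) * (α − γ))
  c₂ = β ÷ ((β − α) * (β − γ))
  c₃ = γ ÷ ((γ − α) * (γ − β))

  -- coefficient of x^k/k! in  c₁^N e^{αx} + c₂^N e^{βx} + c₃^N e^{γx}
  egfCoeff : ℕ → ℕ → Carrier
  egfCoeff N k = (c₁ ^ N) * (α ^ k) + (c₂ ^ N) * (β ^ k) + (c₃ ^ N) * (γ ^ k)

  sum4 : ℕ → (ℕ → ℕ → ℕ → ℕ → Carrier) → Carrier
  sum4 m g = sumTo m λ k₁ → sumTo (m ∸ k₁) λ k₂ → sumTo (m ∸ k₁ ∸ k₂) λ k₃ →
               g k₁ k₂ k₃ (m ∸ k₁ ∸ k₂ ∸ k₃)

{-# OPTIONS --safe #-}
module Submission where

-- With wᵢ = cᵢⁿ and u = egfCoeff n, the hypothesis gives U = Aₙ u, and u is the coefficient sequence of the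
-- exponential sum x₁ + x₂ + x₃, xᵢ = wᵢ e^{rᵢ x}, (r₁, r₂, r₃) = (α, β, γ). Multiplying exponential generating
-- functions is binomial convolution, so the multinomial sum is Aₙ⁴ times the coefficients of (x₁ + x₂ + x₃)⁴.
-- In three variables (Σ xᵢ)⁴ = −6 p₄ + 4 p₃ p₁ + 3 p₂² + 12 x₁x₂x₃ p₁ with p_j = Σ xᵢʲ, and p_j has coefficients
-- jᵏ egfCoeff (j n) k, which the hypothesis ties back to T with normalisation j n. Finally x₁x₂x₃ = (c₁c₂c₃)ⁿ eˣ
-- because α + β + γ = 1, and c₁c₂c₃ = αβγ / ∏_{i≠j}(rᵢ − rⱼ) = 1/44 by Vieta and the discriminant −44 of the cubic.

open import Defs
open import Data.Nat.Base using (ℕ; zero; suc; _≤_; _∸_; z≤n; _!; NonZero) renaming (_+_ to _+ℕ_; _*_ to _*ℕ_; _^_ to _^ℕ_)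
open import Data.Nat.Combinatorics using (_C_; nCk≡n!/k![n-k]!; k![n∸k]!∣n!)
open import Data.Nat.DivMod using (_/_; m/n*n≡m; m*n/n≡m; /-congˡ)
import Data.Nat.Properties as ℕ
open import Data.Nat.Properties using (_!≢0; m*n≢0)
open import Data.Nat.Solver using (module +-*-Solver)
open import Data.Fin.Base using (toℕ; fromℕ; inject₁)
open import Data.Fin.Properties using (toℕ-inject₁; toℕ-fromℕ)
open import Relation.Binary.PropositionalEquality as ≡ using (_≡_)
open import Relation.Nullary using (¬_)

n!≡nCk*[k!*[n∸k]!] : ∀ {n k} → k ≤ n → n ! ≡ (n C k) *ℕ (k ! *ℕ (n ∸ k) !)
n!≡nCk*[k!*[n∸k]!] {n} {k} k≤n = ≡.sym (begin
  (n C k) *ℕ (k ! *ℕ (n ∸ k) !)                     ≡⟨ ≡.cong (_*ℕ (k ! *ℕ (n ∸ k) !)) (nCk≡n!/k![n-k]! k≤n) ⟩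
  (n ! / (k ! *ℕ (n ∸ k) !)) *ℕ (k ! *ℕ (n ∸ k) !) ≡⟨ m/n*n≡m (k![n∸k]!∣n! k≤n) ⟩
  n !                                               ∎)
  where
  open ≡.≡-Reasoning
  instance _ = m*n≢0 (k !) ((n ∸ k) !) {{k !≢0}} {{(n ∸ k) !≢0}}

multinomial4≡binomials : ∀ m k₁ k₂ k₃ → k₁ ≤ m → k₂ ≤ m ∸ k₁ → k₃ ≤ m ∸ k₁ ∸ k₂ →
  multinomial4 m k₁ k₂ k₃ (m ∸ k₁ ∸ k₂ ∸ k₃) ≡ (m C k₁) *ℕ ((m ∸ k₁) C k₂) *ℕ ((m ∸ k₁ ∸ k₂) C k₃)
multinomial4≡binomials m k₁ k₂ k₃ h₁ h₂ h₃ = ≡.trans (/-congˡ m!≡binomials*factorials) (m*n/n≡m b₁₂₃ k!s)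
  where
  open ≡.≡-Reasoning
  open +-*-Solver
  k₄ = m ∸ k₁ ∸ k₂ ∸ k₃
  b₁ = m C k₁
  b₂ = (m ∸ k₁) C k₂
  b₃ = (m ∸ k₁ ∸ k₂) C k₃
  b₁₂₃ = b₁ *ℕ b₂ *ℕ b₃
  k!s = k₁ ! *ℕ k₂ ! *ℕ k₃ ! *ℕ k₄ !
  instance
    _ : NonZero k!s
    _ = m*n≢0 _ _ {{m*n≢0 _ _ {{m*n≢0 _ _ {{k₁ !≢0}} {{k₂ !≢0}}}} {{k₃ !≢0}}}} {{k₄ !≢0}}
  m!≡binomials*factorials : m ! ≡ b₁₂₃ *ℕ k!s
  m!≡binomials*factorials = begin
    m !                                                      ≡⟨ n!≡nCk*[k!*[n∸k]!] h₁ ⟩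
    b₁ *ℕ (k₁ ! *ℕ (m ∸ k₁) !)                               ≡⟨ ≡.cong (λ z → b₁ *ℕ (k₁ ! *ℕ z)) (n!≡nCk*[k!*[n∸k]!] h₂) ⟩
    b₁ *ℕ (k₁ ! *ℕ (b₂ *ℕ (k₂ ! *ℕ (m ∸ k₁ ∸ k₂) !)))         ≡⟨ ≡.cong (λ z → b₁ *ℕ (k₁ ! *ℕ (b₂ *ℕ (k₂ ! *ℕ z)))) (n!≡nCk*[k!*[n∸k]!] h₃) ⟩
    b₁ *ℕ (k₁ ! *ℕ (b₂ *ℕ (k₂ ! *ℕ (b₃ *ℕ (k₃ ! *ℕ k₄ !))))) ≡⟨ solve 7 (λ a b c d e f g → a :* (d :* (b :* (e :* (c :* (f :* g))))) := a :* b :* c :* (d :* e :* f :* g)) ≡.refl b₁ b₂ b₃ (k₁ !) (k₂ !) (k₃ !) (k₄ !) ⟩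
    b₁₂₃ *ℕ k!s                                              ∎

module FieldProperties {c ℓ} (F : Char0Field c ℓ) where
  open Char0Field F
  open import Relation.Binary.Reasoning.Setoid setoid
  open import Algebra.Properties.Semiring.Mult semiring using (×1-homo-*; ×-homo-+)
  open import Algebra.Properties.Semiring.Exp semiring using (^-congˡ)
  open import Algebra.Properties.CommutativeSemiring.Exp commutativeSemiring using (^-distrib-*)
  open import Algebra.Solver.Ring.NaturalCoefficients.Default commutativeSemiring using (solve; _:+_; _:*_; _:=_)
  open import Algebra.Properties.AbelianGroup +-abelianGroup using (⁻¹-∙-comm)
  open import Algebra.Properties.Ring ring using (-‿distribˡ-*; -‿distribʳ-*)
  open import Algebra.Properties.Group +-group using (⁻¹-involutive)
  open import Algebra.Properties.Group +-group public
    using () renaming (x∙y⁻¹≈ε⇒x≈y to x−y≈0⇒x≈y; ε⁻¹≈ε to -0#≈0#)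

  1#≉0# : ¬ (1# ≈ 0#)
  1#≉0# 1≈0 with char0 1 (trans (+-identityʳ 1#) 1≈0)
  ... | ()

  ⁻¹-inverseˡ : ∀ {x} → ¬ (x ≈ 0#) → x ⁻¹ * x ≈ 1#
  ⁻¹-inverseˡ {x} x≉0 = trans (*-comm _ _) (⁻¹-inverse x x≉0)

  ⁻¹-cancelˡ : ∀ {x} y → ¬ (x ≈ 0#) → x ⁻¹ * (x * y) ≈ y
  ⁻¹-cancelˡ {x} y x≉0 = begin
    x ⁻¹ * (x * y) ≈⟨ *-assoc _ _ _ ⟨
    x ⁻¹ * x * y   ≈⟨ *-congʳ (⁻¹-inverseˡ x≉0) ⟩
    1# * y         ≈⟨ *-identityˡ y ⟩
    y              ∎

  ÷-*-cancel : ∀ x {a} → ¬ (a ≈ 0#) → (x ÷ a) * a ≈ x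
  ÷-*-cancel x {a} a≉0 = trans (*-assoc _ _ _) (trans (*-congˡ (⁻¹-inverseˡ a≉0)) (*-identityʳ x))

  ÷-cancel : ∀ x {a} y → ¬ (a ≈ 0#) → (x ÷ a) * (a * y) ≈ x * y
  ÷-cancel x y a≉0 = trans (*-assoc _ _ _) (*-congˡ (⁻¹-cancelˡ y a≉0))

  x*y≈0⇒y≈0 : ∀ {x y} → ¬ (x ≈ 0#) → x * y ≈ 0# → y ≈ 0#
  x*y≈0⇒y≈0 {x} {y} x≉0 xy≈0 = begin
    y              ≈⟨ ⁻¹-cancelˡ y x≉0 ⟨
    x ⁻¹ * (x * y) ≈⟨ *-congˡ xy≈0 ⟩
    x ⁻¹ * 0#      ≈⟨ zeroʳ _ ⟩
    0#             ∎

  *-nonzero : ∀ {x y} → ¬ (x ≈ 0#) → ¬ (y ≈ 0#) → ¬ (x * y ≈ 0#)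
  *-nonzero x≉0 y≉0 xy≈0 = y≉0 (x*y≈0⇒y≈0 x≉0 xy≈0)

  ^-nonzero : ∀ {x} → ¬ (x ≈ 0#) → ∀ k → ¬ (x ^ k ≈ 0#)
  ^-nonzero x≉0 zero    = 1#≉0#
  ^-nonzero x≉0 (suc k) = *-nonzero x≉0 (^-nonzero x≉0 k)

  x≉y⇒x−y≉0 : ∀ {x y} → ¬ (x ≈ y) → ¬ (x − y ≈ 0#)
  x≉y⇒x−y≉0 x≉y x−y≈0 = x≉y (x−y≈0⇒x≈y _ _ x−y≈0)

  ⁻¹-unique : ∀ {x y} → ¬ (x ≈ 0#) → x * y ≈ 1# → x ⁻¹ ≈ y
  ⁻¹-unique {x} {y} x≉0 xy≈1 = begin
    x ⁻¹           ≈⟨ *-identityʳ _ ⟨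
    x ⁻¹ * 1#      ≈⟨ *-congˡ xy≈1 ⟨
    x ⁻¹ * (x * y) ≈⟨ ⁻¹-cancelˡ y x≉0 ⟩
    y              ∎

  ⁻¹-*-cancelʳ : ∀ {a b d} → a * d ≈ 1# → ¬ (b ≈ 0#) → (a * b) ⁻¹ * b ≈ d
  ⁻¹-*-cancelʳ {a} {b} {d} ad≈1 b≉0 = begin
    (a * b) ⁻¹ * b     ≈⟨ *-congʳ (⁻¹-unique ab≉0 ab*db⁻¹≈1) ⟩
    d * b ⁻¹ * b       ≈⟨ *-assoc _ _ _ ⟩
    d * (b ⁻¹ * b)     ≈⟨ *-congˡ (⁻¹-inverseˡ b≉0) ⟩
    d * 1#             ≈⟨ *-identityʳ d ⟩
    d                  ∎
    where
    a≉0 : ¬ (a ≈ 0#)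
    a≉0 a≈0 = 1#≉0# (trans (sym ad≈1) (trans (*-congʳ a≈0) (zeroˡ d)))
    ab≉0 = *-nonzero a≉0 b≉0
    ab*db⁻¹≈1 : a * b * (d * b ⁻¹) ≈ 1#
    ab*db⁻¹≈1 = begin
      a * b * (d * b ⁻¹)    ≈⟨ solve 4 (λ a b d b' → a :* b :* (d :* b') := (a :* d) :* (b :* b')) refl a b d (b ⁻¹) ⟩
      (a * d) * (b * b ⁻¹)  ≈⟨ *-cong ad≈1 (⁻¹-inverse b b≉0) ⟩
      1# * 1#               ≈⟨ *-identityˡ 1# ⟩
      1#                    ∎

  ×≈⟦⟧* : ∀ n x → n × x ≈ ⟦ n ⟧ * x
  ×≈⟦⟧* zero    x = sym (zeroˡ x)
  ×≈⟦⟧* (suc n) x = begin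
    x + n × x           ≈⟨ +-cong (sym (*-identityˡ x)) (×≈⟦⟧* n x) ⟩
    1# * x + ⟦ n ⟧ * x  ≈⟨ distribʳ x 1# ⟦ n ⟧ ⟨
    (1# + ⟦ n ⟧) * x    ∎

  ⟦⟧-homo-+ : ∀ a b → ⟦ a +ℕ b ⟧ ≈ ⟦ a ⟧ + ⟦ b ⟧
  ⟦⟧-homo-+ a b = ×-homo-+ 1# a b

  ⟦⟧-homo-* : ∀ a b → ⟦ a *ℕ b ⟧ ≈ ⟦ a ⟧ * ⟦ b ⟧
  ⟦⟧-homo-* = ×1-homo-*

  ⟦⟧-homo-^ : ∀ a k → ⟦ a ^ℕ k ⟧ ≈ ⟦ a ⟧ ^ k
  ⟦⟧-homo-^ a zero    = +-identityʳ 1#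
  ⟦⟧-homo-^ a (suc k) = trans (⟦⟧-homo-* a (a ^ℕ k)) (*-congˡ (⟦⟧-homo-^ a k))

  1#^k≈1# : ∀ k → 1# ^ k ≈ 1#
  1#^k≈1# zero    = refl
  1#^k≈1# (suc k) = trans (*-identityˡ _) (1#^k≈1# k)

  −-zero : ∀ {a b} → a ≈ 0# → b ≈ 0# → a − b ≈ 0#
  −-zero a≈0 b≈0 = trans (+-cong a≈0 (trans (-‿cong b≈0) -0#≈0#)) (+-identityʳ 0#)

  +-zero : ∀ {a b} → a ≈ 0# → b ≈ 0# → a + b ≈ 0#
  +-zero a≈0 b≈0 = trans (+-cong a≈0 b≈0) (+-identityʳ 0#)

  *-zeroˡ : ∀ {a} b → a ≈ 0# → a * b ≈ 0#
  *-zeroˡ b a≈0 = trans (*-congʳ a≈0) (zeroˡ b)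

  cancel-difference : ∀ {a b t} → ¬ (a ≈ b) → (a − b) * t ≈ 0# → t ≈ 0#
  cancel-difference a≉b = x*y≈0⇒y≈0 (x≉y⇒x−y≉0 a≉b)

  ⟦j^k⟧*x^k≈[j×x]^k : ∀ j k x → ⟦ j ^ℕ k ⟧ * x ^ k ≈ (j × x) ^ k
  ⟦j^k⟧*x^k≈[j×x]^k j k x = begin
    ⟦ j ^ℕ k ⟧ * x ^ k   ≈⟨ *-congʳ (⟦⟧-homo-^ j k) ⟩
    ⟦ j ⟧ ^ k * x ^ k    ≈⟨ ^-distrib-* ⟦ j ⟧ x k ⟨
    (⟦ j ⟧ * x) ^ k      ≈⟨ ^-congˡ k (×≈⟦⟧* j x) ⟨
    (j × x) ^ k          ∎

  -‿homo-+ : ∀ x y → - (x + y) ≈ - x + - y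
  -‿homo-+ x y = sym (⁻¹-∙-comm x y)

  -x*-y≈x*y : ∀ x y → (- x) * (- y) ≈ x * y
  -x*-y≈x*y x y = begin
    (- x) * (- y)   ≈⟨ -‿distribˡ-* x (- y) ⟨
    - (x * (- y))   ≈⟨ -‿cong (-‿distribʳ-* x y) ⟨
    - (- (x * y))   ≈⟨ ⁻¹-involutive (x * y) ⟩
    x * y           ∎

  +≈+⇒−≈− : ∀ {x y x′ y′} → x + y′ ≈ x′ + y → x − y ≈ x′ − y′
  +≈+⇒−≈− {x} {y} {x′} {y′} x+y′≈x′+y = begin
    x − y                         ≈⟨ +-identityʳ _ ⟨
    (x − y) + 0#                  ≈⟨ +-congˡ (-‿inverseʳ y′) ⟨
    (x − y) + (y′ − y′)           ≈⟨ solve 4 (λ x -y y′ -y′ → (x :+ -y) :+ (y′ :+ -y′) := (x :+ y′) :+ (-y′ :+ -y)) refl x (- y) y′ (- y′) ⟩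
    (x + y′) + (- y′ + - y)       ≈⟨ +-congʳ x+y′≈x′+y ⟩
    (x′ + y) + (- y′ + - y)       ≈⟨ solve 4 (λ x′ y -y′ -y → (x′ :+ y) :+ (-y′ :+ -y) := (x′ :+ -y′) :+ (y :+ -y)) refl x′ y (- y′) (- y) ⟩
    (x′ − y′) + (y − y)           ≈⟨ +-congˡ (-‿inverseʳ y) ⟩
    (x′ − y′) + 0#                ≈⟨ +-identityʳ _ ⟩
    x′ − y′                       ∎

  x+t≈p+q+r⇒x≈-t+p+q+r : ∀ {x t p q r} → x + t ≈ p + q + r → x ≈ - t + p + q + r
  x+t≈p+q+r⇒x≈-t+p+q+r {x} {t} {p} {q} {r} x+t≈p+q+r = begin
    x                    ≈⟨ +-identityʳ x ⟨
    x + 0#               ≈⟨ +-congˡ (-‿inverseʳ t) ⟨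
    x + (t + - t)        ≈⟨ +-assoc x t (- t) ⟨
    x + t + - t          ≈⟨ +-congʳ x+t≈p+q+r ⟩
    p + q + r + - t      ≈⟨ solve 4 (λ p q r -t → p :+ q :+ r :+ -t := -t :+ p :+ q :+ r) refl p q r (- t) ⟩
    - t + p + q + r      ∎

module BinomialConvolution {c ℓ} (F : Char0Field c ℓ) where
  open Char0Field F
  open FieldProperties F
  open import Relation.Binary.Reasoning.Setoid setoid
  open import Algebra.Solver.Ring.NaturalCoefficients.Default commutativeSemiring using (solve; _:+_; _:*_; _:=_)
  import Algebra.Properties.Monoid.Sum +-monoid as Σ
  import Algebra.Properties.Semiring.Binomial as Binomial
  open import Algebra.Properties.CommutativeSemigroup *-commutativeSemigroup using (x∙yz≈y∙xz)

  sumTo-cong : ∀ m {f g : ℕ → Carrier} → (∀ k → k ≤ m → f k ≈ g k) → sumTo m f ≈ sumTo m g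
  sumTo-cong zero    f≈g = f≈g 0 z≤n
  sumTo-cong (suc m) f≈g = +-cong (sumTo-cong m (λ k k≤m → f≈g k (ℕ.m≤n⇒m≤1+n k≤m))) (f≈g (suc m) ℕ.≤-refl)

  sumTo-*ˡ : ∀ m a (f : ℕ → Carrier) → a * sumTo m f ≈ sumTo m (λ k → a * f k)
  sumTo-*ˡ zero    a f = refl
  sumTo-*ˡ (suc m) a f = trans (distribˡ a _ _) (+-congʳ (sumTo-*ˡ m a f))

  sumTo-+ : ∀ m (f g : ℕ → Carrier) → sumTo m (λ k → f k + g k) ≈ sumTo m f + sumTo m g
  sumTo-+ zero    f g = refl
  sumTo-+ (suc m) f g = trans (+-congʳ (sumTo-+ m f g))
    (solve 4 (λ a b c d → (a :+ b) :+ (c :+ d) := (a :+ c) :+ (b :+ d)) refl (sumTo m f) (sumTo m g) (f (suc m)) (g (suc m)))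

  sumTo-zero : ∀ m → sumTo m (λ _ → 0#) ≈ 0#
  sumTo-zero zero    = refl
  sumTo-zero (suc m) = trans (+-identityʳ _) (sumTo-zero m)

  sumTo≈sum : ∀ m (f : ℕ → Carrier) → sumTo m f ≈ Σ.sum {suc m} (λ i → f (toℕ i))
  sumTo≈sum zero    f = sym (+-identityʳ _)
  sumTo≈sum (suc m) f = begin
    sumTo m f + f (suc m)
      ≈⟨ +-cong (sumTo≈sum m f) (reflexive (≡.cong f (≡.sym (toℕ-fromℕ (suc m))))) ⟩
    Σ.sum {suc m} (λ i → f (toℕ i)) + f (toℕ (fromℕ (suc m)))
      ≈⟨ +-congʳ (reflexive (Σ.sum-cong-≗ {suc m} (λ i → ≡.cong f (≡.sym (toℕ-inject₁ i))))) ⟩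
    Σ.sum {suc m} (λ i → f (toℕ (inject₁ i))) + f (toℕ (fromℕ (suc m)))
      ≈⟨ Σ.sum-init-last {suc m} (λ i → f (toℕ i)) ⟨
    Σ.sum {suc (suc m)} (λ i → f (toℕ i)) ∎

  -- Coefficients of the product of two exponential generating functions.
  infixr 7 _⋆_
  _⋆_ : (ℕ → Carrier) → (ℕ → Carrier) → ℕ → Carrier
  (f ⋆ g) m = sumTo m (λ k → ⟦ m C k ⟧ * f k * g (m ∸ k))

  ⋆-cong : ∀ {f f′ g g′ : ℕ → Carrier} → (∀ k → f k ≈ f′ k) → (∀ k → g k ≈ g′ k) → ∀ m → (f ⋆ g) m ≈ (f′ ⋆ g′) m
  ⋆-cong f≈f′ g≈g′ m = sumTo-cong m (λ k _ → *-cong (*-congˡ (f≈f′ k)) (g≈g′ (m ∸ k)))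

  *-⋆-assocˡ : ∀ a (f g : ℕ → Carrier) m → ((λ k → a * f k) ⋆ g) m ≈ a * (f ⋆ g) m
  *-⋆-assocˡ a f g m = sym (trans (sumTo-*ˡ m a _) (sumTo-cong m (λ k _ →
    solve 4 (λ a b x y → a :* (b :* x :* y) := b :* (a :* x) :* y) refl a ⟦ m C k ⟧ (f k) (g (m ∸ k)))))

  *-⋆-assocʳ : ∀ a (f g : ℕ → Carrier) m → (f ⋆ (λ k → a * g k)) m ≈ a * (f ⋆ g) m
  *-⋆-assocʳ a f g m = sym (trans (sumTo-*ˡ m a _) (sumTo-cong m (λ k _ →
    solve 4 (λ a b x y → a :* (b :* x :* y) := b :* x :* (a :* y)) refl a ⟦ m C k ⟧ (f k) (g (m ∸ k)))))

  ⋆-cong-scaled : ∀ {a b} {f f′ g g′ : ℕ → Carrier} → (∀ k → f k ≈ a * f′ k) → (∀ k → g k ≈ b * g′ k) →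
                  ∀ m → (f ⋆ g) m ≈ (a * b) * (f′ ⋆ g′) m
  ⋆-cong-scaled {a} {b} {f} {f′} {g} {g′} f≈af′ g≈bg′ m = begin
    (f ⋆ g) m                              ≈⟨ ⋆-cong f≈af′ g≈bg′ m ⟩
    ((λ k → a * f′ k) ⋆ (λ k → b * g′ k)) m ≈⟨ *-⋆-assocˡ a f′ (λ k → b * g′ k) m ⟩
    a * (f′ ⋆ (λ k → b * g′ k)) m           ≈⟨ *-congˡ (*-⋆-assocʳ b f′ g′ m) ⟩
    a * (b * (f′ ⋆ g′) m)                   ≈⟨ *-assoc a b _ ⟨
    (a * b) * (f′ ⋆ g′) m                   ∎

  ⋆-distribʳ-+ : ∀ (f h g : ℕ → Carrier) m → ((λ k → f k + h k) ⋆ g) m ≈ (f ⋆ g) m + (h ⋆ g) m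
  ⋆-distribʳ-+ f h g m = trans (sumTo-cong m (λ k _ →
    solve 4 (λ b x z y → b :* (x :+ z) :* y := b :* x :* y :+ b :* z :* y) refl ⟦ m C k ⟧ (f k) (h k) (g (m ∸ k))))
    (sumTo-+ m _ _)

  ⋆-distribˡ-+ : ∀ (f g h : ℕ → Carrier) m → (f ⋆ (λ k → g k + h k)) m ≈ (f ⋆ g) m + (f ⋆ h) m
  ⋆-distribˡ-+ f g h m = trans (sumTo-cong m (λ k _ →
    solve 4 (λ b x y z → b :* x :* (y :+ z) := b :* x :* y :+ b :* x :* z) refl ⟦ m C k ⟧ (f k) (g (m ∸ k)) (h (m ∸ k))))
    (sumTo-+ m _ _)

  ⋆-zeroˡ : ∀ (g : ℕ → Carrier) m → ((λ _ → 0#) ⋆ g) m ≈ 0#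
  ⋆-zeroˡ g m = trans (sumTo-cong m (λ k _ → trans (*-congʳ (zeroʳ _)) (zeroˡ _))) (sumTo-zero m)

  ⋆-zeroʳ : ∀ (f : ℕ → Carrier) m → (f ⋆ (λ _ → 0#)) m ≈ 0#
  ⋆-zeroʳ f m = trans (sumTo-cong m (λ k _ → zeroʳ _)) (sumTo-zero m)

  ^-⋆-^ : ∀ x y m → ((x ^_) ⋆ (y ^_)) m ≈ (x + y) ^ m
  ^-⋆-^ x y m = sym (begin
    (x + y) ^ m
      ≈⟨ Binomial.theorem semiring x y (*-comm x y) m ⟩
    Binomial.binomialExpansion semiring x y m
      ≈⟨ Σ.sum-cong-≋ {suc m} (λ i → ×≈⟦⟧* (m C toℕ i) (x ^ toℕ i * y ^ (m ∸ toℕ i))) ⟩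
    Σ.sum {suc m} (λ i → ⟦ m C toℕ i ⟧ * (x ^ toℕ i * y ^ (m ∸ toℕ i)))
      ≈⟨ sumTo≈sum m _ ⟨
    sumTo m (λ k → ⟦ m C k ⟧ * (x ^ k * y ^ (m ∸ k)))
      ≈⟨ sumTo-cong m (λ k _ → sym (*-assoc _ _ _)) ⟩
    ((x ^_) ⋆ (y ^_)) m ∎)

  -- Coefficients of f(j x).
  dilate : ℕ → (ℕ → Carrier) → ℕ → Carrier
  dilate j f k = ⟦ j ^ℕ k ⟧ * f k

  dilate-⋆ : ∀ j (f g : ℕ → Carrier) m → dilate j (f ⋆ g) m ≈ (dilate j f ⋆ dilate j g) m
  dilate-⋆ j f g m = trans (sumTo-*ˡ m ⟦ j ^ℕ m ⟧ _) (sumTo-cong m term)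
    where
    term : ∀ k → k ≤ m → ⟦ j ^ℕ m ⟧ * (⟦ m C k ⟧ * f k * g (m ∸ k)) ≈ ⟦ m C k ⟧ * dilate j f k * dilate j g (m ∸ k)
    term k k≤m = begin
      ⟦ j ^ℕ m ⟧ * (⟦ m C k ⟧ * f k * g (m ∸ k))
        ≈⟨ *-congʳ (reflexive (≡.cong (λ i → ⟦ j ^ℕ i ⟧) (≡.sym (ℕ.m+[n∸m]≡n k≤m)))) ⟩
      ⟦ j ^ℕ (k +ℕ (m ∸ k)) ⟧ * (⟦ m C k ⟧ * f k * g (m ∸ k))
        ≈⟨ *-congʳ (trans (reflexive (≡.cong ⟦_⟧ (ℕ.^-distribˡ-+-* j k (m ∸ k)))) (⟦⟧-homo-* (j ^ℕ k) (j ^ℕ (m ∸ k)))) ⟩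
      ⟦ j ^ℕ k ⟧ * ⟦ j ^ℕ (m ∸ k) ⟧ * (⟦ m C k ⟧ * f k * g (m ∸ k))
        ≈⟨ solve 5 (λ a b d x y → a :* b :* (d :* x :* y) := d :* (a :* x) :* (b :* y)) refl ⟦ j ^ℕ k ⟧ ⟦ j ^ℕ (m ∸ k) ⟧ ⟦ m C k ⟧ (f k) (g (m ∸ k)) ⟩
      ⟦ m C k ⟧ * dilate j f k * dilate j g (m ∸ k) ∎

  multinomial-⋆ : ∀ (f : ℕ → Carrier) m →
    sumTo m (λ k₁ → sumTo (m ∸ k₁) λ k₂ → sumTo (m ∸ k₁ ∸ k₂) λ k₃ →
      ⟦ multinomial4 m k₁ k₂ k₃ (m ∸ k₁ ∸ k₂ ∸ k₃) ⟧ * f k₁ * f k₂ * f k₃ * f (m ∸ k₁ ∸ k₂ ∸ k₃))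
      ≈ (f ⋆ f ⋆ f ⋆ f) m
  multinomial-⋆ f m = sumTo-cong m λ k₁ h₁ → sym (distribute (m ∸ k₁) λ k₂ h₂ →
    trans (sym (*-assoc _ _ _)) (distribute (m ∸ k₁ ∸ k₂) λ k₃ h₃ → term k₁ k₂ k₃ h₁ h₂ h₃))
    where
    distribute : ∀ s {a} {g h : ℕ → Carrier} → (∀ k → k ≤ s → a * g k ≈ h k) → a * sumTo s g ≈ sumTo s h
    distribute s {a} {g} ag≈h = trans (sumTo-*ˡ s a g) (sumTo-cong s ag≈h)
    term : ∀ k₁ k₂ k₃ → k₁ ≤ m → k₂ ≤ m ∸ k₁ → k₃ ≤ m ∸ k₁ ∸ k₂ →
      ⟦ m C k₁ ⟧ * f k₁ * (⟦ (m ∸ k₁) C k₂ ⟧ * f k₂) * (⟦ (m ∸ k₁ ∸ k₂) C k₃ ⟧ * f k₃ * f (m ∸ k₁ ∸ k₂ ∸ k₃))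
        ≈ ⟦ multinomial4 m k₁ k₂ k₃ (m ∸ k₁ ∸ k₂ ∸ k₃) ⟧ * f k₁ * f k₂ * f k₃ * f (m ∸ k₁ ∸ k₂ ∸ k₃)
    term k₁ k₂ k₃ h₁ h₂ h₃ = begin
      b₁ * f k₁ * (b₂ * f k₂) * (b₃ * f k₃ * f k₄)
        ≈⟨ solve 7 (λ b₁ b₂ b₃ x₁ x₂ x₃ x₄ → b₁ :* x₁ :* (b₂ :* x₂) :* (b₃ :* x₃ :* x₄) := b₁ :* b₂ :* b₃ :* x₁ :* x₂ :* x₃ :* x₄)
                   refl b₁ b₂ b₃ (f k₁) (f k₂) (f k₃) (f k₄) ⟩
      b₁ * b₂ * b₃ * f k₁ * f k₂ * f k₃ * f k₄
        ≈⟨ *-congʳ (*-congʳ (*-congʳ (*-congʳ multinomial≈binomials))) ⟨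
      ⟦ multinomial4 m k₁ k₂ k₃ k₄ ⟧ * f k₁ * f k₂ * f k₃ * f k₄ ∎
      where
      k₄ = m ∸ k₁ ∸ k₂ ∸ k₃
      b₁ = ⟦ m C k₁ ⟧
      b₂ = ⟦ (m ∸ k₁) C k₂ ⟧
      b₃ = ⟦ (m ∸ k₁ ∸ k₂) C k₃ ⟧
      multinomial≈binomials : ⟦ multinomial4 m k₁ k₂ k₃ k₄ ⟧ ≈ b₁ * b₂ * b₃
      multinomial≈binomials = trans (reflexive (≡.cong ⟦_⟧ (multinomial4≡binomials m k₁ k₂ k₃ h₁ h₂ h₃)))
        (trans (⟦⟧-homo-* ((m C k₁) *ℕ ((m ∸ k₁) C k₂)) ((m ∸ k₁ ∸ k₂) C k₃)) (*-congʳ (⟦⟧-homo-* (m C k₁) ((m ∸ k₁) C k₂))))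

  dilate-scaled : ∀ j {a} {f g : ℕ → Carrier} → (∀ k → f k ≈ a * g k) → ∀ k → dilate j f k ≈ a * dilate j g k
  dilate-scaled j {a} {g = g} f≈ag k = trans (*-congˡ (f≈ag k)) (x∙yz≈y∙xz ⟦ j ^ℕ k ⟧ a (g k))

  ⋆⁴-scaled : ∀ {a} {f g : ℕ → Carrier} → (∀ k → f k ≈ a * g k) → ∀ m → (f ⋆ f ⋆ f ⋆ f) m ≈ a ^ 4 * (g ⋆ g ⋆ g ⋆ g) m
  ⋆⁴-scaled {a} {f} {g} f≈ag m = begin
    (f ⋆ f ⋆ f ⋆ f) m                ≈⟨ ⋆-cong-scaled f≈ag (⋆-cong-scaled f≈ag (⋆-cong-scaled f≈ag f≈ag)) m ⟩
    a * (a * (a * a)) * (g ⋆ g ⋆ g ⋆ g) m ≈⟨ *-congʳ (*-congˡ (*-congˡ (*-congˡ (*-identityʳ a)))) ⟨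
    a ^ 4 * (g ⋆ g ⋆ g ⋆ g) m         ∎

module ExponentialSums {c ℓ} (F : Char0Field c ℓ) where
  open Char0Field F
  open BinomialConvolution F
  open import Relation.Binary.Reasoning.Setoid setoid
  open import Algebra.Solver.Ring.NaturalCoefficients.Default commutativeSemiring
    using (Polynomial; var; con; _:+_; _:*_; _:^_; _:=_; prove; solve) renaming (⟦_⟧ to ⟦_⟧ₚ)
  open import Algebra.Properties.Semiring.Exp semiring using (^-congˡ)
  open import Data.Fin.Base using (Fin)
  open import Data.Fin using (#_)
  open import Data.List.Base using (List; []; _∷_; _++_; map)
  open import Data.Vec.Base using (Vec)

  -- coeff · e^{(mα α + mβ β + mγ γ) x}, with coeff a polynomial in the weights w₁ w₂ w₃ (variables 0–2);
  -- variables 3–17 stand for the values at a fixed index of the fifteen degree-4 exponentials, see degree4Var.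
  record ExpTerm : Set c where
    constructor term
    field
      coeff    : Polynomial 18
      mα mβ mγ : ℕ

  ExpSum : Set c
  ExpSum = List ExpTerm

  infixr 7 _·_ _⊗_
  _·_ : ExpTerm → ExpTerm → ExpTerm
  term p a b d · term q a′ b′ d′ = term (p :* q) (a +ℕ a′) (b +ℕ b′) (d +ℕ d′)

  _⊗_ : ExpSum → ExpSum → ExpSum
  []      ⊗ M = []
  (t ∷ L) ⊗ M = map (t ·_) M ++ (L ⊗ M)

  w₁ w₂ w₃ : Polynomial 18
  w₁ = var (# 0)
  w₂ = var (# 1)
  w₃ = var (# 2)

  powerSum : ℕ → ExpSum
  powerSum j = term (w₁ :^ j) j 0 0 ∷ term (w₂ :^ j) 0 j 0 ∷ term (w₃ :^ j) 0 0 j ∷ []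

  x₁x₂x₃ : ExpSum
  x₁x₂x₃ = term (w₁ :* w₂ :* w₃) 1 1 1 ∷ []

  -- Junk value # 0 off degree 4: only lists homogeneous of degree 4 are ever encoded.
  degree4Var : ℕ → ℕ → ℕ → Fin 18
  degree4Var 4 0 0 = # 3
  degree4Var 0 4 0 = # 4
  degree4Var 0 0 4 = # 5
  degree4Var 3 1 0 = # 6
  degree4Var 3 0 1 = # 7
  degree4Var 1 3 0 = # 8
  degree4Var 0 3 1 = # 9
  degree4Var 1 0 3 = # 10
  degree4Var 0 1 3 = # 11
  degree4Var 2 2 0 = # 12
  degree4Var 2 0 2 = # 13
  degree4Var 0 2 2 = # 14
  degree4Var 2 1 1 = # 15
  degree4Var 1 2 1 = # 16
  degree4Var 1 1 2 = # 17
  degree4Var _ _ _ = # 0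

  toPoly : ExpSum → Polynomial 18
  toPoly []                 = con 0
  toPoly (term p a b d ∷ L) = p :* var (degree4Var a b d) :+ toPoly L

  -- (x₁+x₂+x₃)⁴ + 6 p₄ = 4 p₃ p₁ + 3 p₂² + 12 x₁x₂x₃ p₁
  fourthPower powerSumExpansion : Polynomial 18
  fourthPower = toPoly (powerSum 1 ⊗ powerSum 1 ⊗ powerSum 1 ⊗ powerSum 1) :+ con 6 :* toPoly (powerSum 4)
  powerSumExpansion = con 4 :* toPoly (powerSum 3 ⊗ powerSum 1) :+ con 3 :* toPoly (powerSum 2 ⊗ powerSum 2)
                        :+ con 12 :* toPoly (powerSum 1 ⊗ x₁x₂x₃)

  powerSumIdentity : ∀ ρ → ⟦ fourthPower ⟧ₚ ρ ≈ ⟦ powerSumExpansion ⟧ₚ ρ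
  powerSumIdentity ρ = prove ρ fourthPower powerSumExpansion refl

  module Sequences (α β γ : Carrier) where
    open import Algebra.Properties.Semiring.Mult semiring using (×-homo-+)

    rate : ℕ → ℕ → ℕ → Carrier
    rate a b d = a × α + b × β + d × γ

    rate-+ : ∀ a b d a′ b′ d′ → rate (a +ℕ a′) (b +ℕ b′) (d +ℕ d′) ≈ rate a b d + rate a′ b′ d′
    rate-+ a b d a′ b′ d′ = trans (+-cong (+-cong (×-homo-+ α a a′) (×-homo-+ β b b′)) (×-homo-+ γ d d′))
      (solve 6 (λ x y z x′ y′ z′ → (x :+ x′) :+ (y :+ y′) :+ (z :+ z′) := (x :+ y :+ z) :+ (x′ :+ y′ :+ z′)) refl
        (a × α) (b × β) (d × γ) (a′ × α) (b′ × β) (d′ × γ))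

    module At (ρ : Vec Carrier 18) where

      toSeq : ExpSum → ℕ → Carrier
      toSeq []                 k = 0#
      toSeq (term p a b d ∷ L) k = ⟦ p ⟧ₚ ρ * rate a b d ^ k + toSeq L k

      toSeq-++ : ∀ L M k → toSeq (L ++ M) k ≈ toSeq L k + toSeq M k
      toSeq-++ []      M k = sym (+-identityˡ _)
      toSeq-++ (_ ∷ L) M k = trans (+-congˡ (toSeq-++ L M k)) (sym (+-assoc _ _ _))

      ⋆-toSeq : ∀ L M m → (toSeq L ⋆ toSeq M) m ≈ toSeq (L ⊗ M) m
      ⋆-toSeq []                 M m = ⋆-zeroˡ (toSeq M) m
      ⋆-toSeq (term p a b d ∷ L) M m = begin
        (toSeq (term p a b d ∷ L) ⋆ toSeq M) m
          ≈⟨ ⋆-distribʳ-+ (λ k → ⟦ p ⟧ₚ ρ * rate a b d ^ k) (toSeq L) (toSeq M) m ⟩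
        ((λ k → ⟦ p ⟧ₚ ρ * rate a b d ^ k) ⋆ toSeq M) m + (toSeq L ⋆ toSeq M) m
          ≈⟨ +-cong (term-⋆-toSeq M) (⋆-toSeq L M m) ⟩
        toSeq (map (term p a b d ·_) M) m + toSeq (L ⊗ M) m
          ≈⟨ toSeq-++ (map (term p a b d ·_) M) (L ⊗ M) m ⟨
        toSeq ((term p a b d ∷ L) ⊗ M) m ∎
        where
        x = ⟦ p ⟧ₚ ρ
        r = rate a b d
        term-⋆-toSeq : ∀ M → ((λ k → x * r ^ k) ⋆ toSeq M) m ≈ toSeq (map (term p a b d ·_) M) m
        term-⋆-toSeq [] = ⋆-zeroʳ _ m
        term-⋆-toSeq (term q a′ b′ d′ ∷ M) = begin
          ((λ k → x * r ^ k) ⋆ (λ k → y * r′ ^ k + toSeq M k)) m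
            ≈⟨ ⋆-distribˡ-+ _ (λ k → y * r′ ^ k) (toSeq M) m ⟩
          ((λ k → x * r ^ k) ⋆ (λ k → y * r′ ^ k)) m + ((λ k → x * r ^ k) ⋆ toSeq M) m
            ≈⟨ +-cong (⋆-cong-scaled {f′ = r ^_} {g′ = r′ ^_} (λ _ → refl) (λ _ → refl) m) (term-⋆-toSeq M) ⟩
          x * y * ((r ^_) ⋆ (r′ ^_)) m + toSeq (map (term p a b d ·_) M) m
            ≈⟨ +-congʳ (*-congˡ (trans (^-⋆-^ r r′ m) (^-congˡ m (sym (rate-+ a b d a′ b′ d′))))) ⟩
          x * y * rate (a +ℕ a′) (b +ℕ b′) (d +ℕ d′) ^ m + toSeq (map (term p a b d ·_) M) m ∎
          where
          y = ⟦ q ⟧ₚ ρ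
          r′ = rate a′ b′ d′

module IntegerCoefficients {c ℓ} (F : Char0Field c ℓ) where
  open Char0Field F hiding (T)
  open FieldProperties F
  open import Relation.Binary.Reasoning.Setoid setoid
  open import Algebra.Solver.Ring.NaturalCoefficients.Default commutativeSemiring using (solve; _:+_; _:*_; _:=_)
  open import Algebra.Bundles using (RawRing)
  open import Algebra.Solver.Ring.AlmostCommutativeRing using (_-Raw-AlmostCommutative⟶_; fromCommutativeRing)
  open import Algebra.Properties.Ring ring using (-‿distribˡ-*; -‿distribʳ-*)
  open import Algebra.Properties.Group +-group using (⁻¹-involutive)
  open import Data.Bool.Base using (T)
  open import Relation.Nullary using (yes; no)
  open import Data.Maybe.Base using (Maybe; just; nothing; is-just)
  open import Data.Vec.Base using (Vec)
  open import Data.Vec.Relation.Binary.Pointwise.Inductive as Pointwise using (Pointwise)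

  -- Integers as formal differences: coefficient equality must be decidable, which equality in F is not.
  record Diff : Set where
    constructor _⊖_
    field
      pos neg : ℕ

  diffRawRing : RawRing _ _
  diffRawRing = record
    { Carrier = Diff
    ; _≈_     = _≡_
    ; _+_     = λ { (a ⊖ b) (a′ ⊖ b′) → (a +ℕ a′) ⊖ (b +ℕ b′) }
    ; _*_     = λ { (a ⊖ b) (a′ ⊖ b′) → (a *ℕ a′ +ℕ b *ℕ b′) ⊖ (a *ℕ b′ +ℕ b *ℕ a′) }
    ; -_      = λ { (a ⊖ b) → b ⊖ a }
    ; 0#      = 0 ⊖ 0
    ; 1#      = 1 ⊖ 0
    }

  ⟦_⟧ᵈ : Diff → Carrier
  ⟦ a ⊖ b ⟧ᵈ = ⟦ a ⟧ − ⟦ b ⟧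

  ⟦k⊖0⟧ᵈ≈⟦k⟧ : ∀ k → ⟦ k ⊖ 0 ⟧ᵈ ≈ ⟦ k ⟧
  ⟦k⊖0⟧ᵈ≈⟦k⟧ k = trans (+-congˡ -0#≈0#) (+-identityʳ _)

  ⟦1⊖0⟧ᵈ≈1# : ⟦ 1 ⊖ 0 ⟧ᵈ ≈ 1#
  ⟦1⊖0⟧ᵈ≈1# = trans (⟦k⊖0⟧ᵈ≈⟦k⟧ 1) (+-identityʳ 1#)

  ⟦⟧ᵈ-morphism : diffRawRing -Raw-AlmostCommutative⟶ fromCommutativeRing commRing
  ⟦⟧ᵈ-morphism = record
    { ⟦_⟧    = ⟦_⟧ᵈ
    ; +-homo = +-homo
    ; *-homo = *-homo
    ; -‿homo = λ { (a ⊖ b) → sym (trans (-‿homo-+ _ _) (trans (+-congˡ (⁻¹-involutive _)) (+-comm _ _))) }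
    ; 0-homo = -‿inverseʳ 0#
    ; 1-homo = ⟦1⊖0⟧ᵈ≈1#
    }
    where
    +-homo : ∀ x y → ⟦ RawRing._+_ diffRawRing x y ⟧ᵈ ≈ ⟦ x ⟧ᵈ + ⟦ y ⟧ᵈ
    +-homo (a ⊖ b) (a′ ⊖ b′) = begin
      ⟦ a +ℕ a′ ⟧ + - ⟦ b +ℕ b′ ⟧
        ≈⟨ +-cong (⟦⟧-homo-+ a a′) (trans (-‿cong (⟦⟧-homo-+ b b′)) (-‿homo-+ _ _)) ⟩
      (⟦ a ⟧ + ⟦ a′ ⟧) + (- ⟦ b ⟧ + - ⟦ b′ ⟧)
        ≈⟨ solve 4 (λ x x′ y y′ → (x :+ x′) :+ (y :+ y′) := (x :+ y) :+ (x′ :+ y′)) refl ⟦ a ⟧ ⟦ a′ ⟧ (- ⟦ b ⟧) (- ⟦ b′ ⟧) ⟩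
      (⟦ a ⟧ + - ⟦ b ⟧) + (⟦ a′ ⟧ + - ⟦ b′ ⟧) ∎
    *-homo : ∀ x y → ⟦ RawRing._*_ diffRawRing x y ⟧ᵈ ≈ ⟦ x ⟧ᵈ * ⟦ y ⟧ᵈ
    *-homo (a ⊖ b) (a′ ⊖ b′) = begin
      ⟦ a *ℕ a′ +ℕ b *ℕ b′ ⟧ + - ⟦ a *ℕ b′ +ℕ b *ℕ a′ ⟧
        ≈⟨ +-cong (homo₂ a a′ b b′) (trans (-‿cong (homo₂ a b′ b a′)) (-‿homo-+ _ _)) ⟩
      (x * x′ + y * y′) + (- (x * y′) + - (y * x′))
        ≈⟨ +-cong (+-congˡ (sym (-x*-y≈x*y y y′)))
                  (+-cong (-‿distribʳ-* x y′) (-‿distribˡ-* y x′)) ⟩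
      (x * x′ + (- y) * (- y′)) + (x * (- y′) + (- y) * x′)
        ≈⟨ solve 4 (λ x x′ y y′ → (x :* x′ :+ y :* y′) :+ (x :* y′ :+ y :* x′) := (x :+ y) :* (x′ :+ y′)) refl x x′ (- y) (- y′) ⟩
      (x + - y) * (x′ + - y′) ∎
      where
      x = ⟦ a ⟧; y = ⟦ b ⟧; x′ = ⟦ a′ ⟧; y′ = ⟦ b′ ⟧
      homo₂ : ∀ p q r s → ⟦ p *ℕ q +ℕ r *ℕ s ⟧ ≈ ⟦ p ⟧ * ⟦ q ⟧ + ⟦ r ⟧ * ⟦ s ⟧
      homo₂ p q r s = trans (⟦⟧-homo-+ (p *ℕ q) (r *ℕ s)) (+-cong (⟦⟧-homo-* p q) (⟦⟧-homo-* r s))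

  ⟦⟧ᵈ-≈? : ∀ x y → Maybe (⟦ x ⟧ᵈ ≈ ⟦ y ⟧ᵈ)
  ⟦⟧ᵈ-≈? (a ⊖ b) (a′ ⊖ b′) with a +ℕ b′ ℕ.≟ a′ +ℕ b
  ... | no _            = nothing
  ... | yes a+b′≡a′+b = just (+≈+⇒−≈− (trans (sym (⟦⟧-homo-+ a b′)) (trans (reflexive (≡.cong ⟦_⟧ a+b′≡a′+b)) (⟦⟧-homo-+ a′ b))))

  open import Algebra.Solver.Ring diffRawRing (fromCommutativeRing commRing) ⟦⟧ᵈ-morphism ⟦⟧ᵈ-≈? public
    using (Polynomial; var; con; _:+_; _:*_; _:-_; :-_; _:^_; op; [+]; [*]) renaming (⟦_⟧ to ⟦_⟧ᶻ)
  open import Algebra.Solver.Ring diffRawRing (fromCommutativeRing commRing) ⟦⟧ᵈ-morphism ⟦⟧ᵈ-≈?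
    using (prove; normalise; _≟N_; ⟦_⟧N-cong)
  open import Algebra.Properties.Semiring.Exp semiring using (^-congˡ)

  byNormalisation : ∀ {n} (p q : Polynomial n) {_ : T (is-just (normalise p ≟N normalise q))} →
                    ∀ ρ → ⟦ p ⟧ᶻ ρ ≈ ⟦ q ⟧ᶻ ρ
  byNormalisation p q ρ with normalise p ≟N normalise q
  ... | just p≈q = prove ρ p q (⟦ p≈q ⟧N-cong ρ)

  ⟦⟧-cong : ∀ {n} (p : Polynomial n) {ρ ρ′ : Vec Carrier n} → Pointwise _≈_ ρ ρ′ → ⟦ p ⟧ᶻ ρ ≈ ⟦ p ⟧ᶻ ρ′
  ⟦⟧-cong (op [+] p q) ρ≈ρ′ = +-cong (⟦⟧-cong p ρ≈ρ′) (⟦⟧-cong q ρ≈ρ′)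
  ⟦⟧-cong (op [*] p q) ρ≈ρ′ = *-cong (⟦⟧-cong p ρ≈ρ′) (⟦⟧-cong q ρ≈ρ′)
  ⟦⟧-cong (con _)      ρ≈ρ′ = refl
  ⟦⟧-cong (var i)      ρ≈ρ′ = Pointwise.lookup ρ≈ρ′ i
  ⟦⟧-cong (p :^ k)     ρ≈ρ′ = ^-congˡ k (⟦⟧-cong p ρ≈ρ′)
  ⟦⟧-cong (:- p)       ρ≈ρ′ = -‿cong (⟦⟧-cong p ρ≈ρ′)

module TribonacciRoots {c ℓ} (F : Char0Field c ℓ) where
  open Char0Field F

  module Roots (α β γ : Carrier)
    (fα≈0 : α ^ 3 − α ^ 2 − α − 1# ≈ 0#) (fβ≈0 : β ^ 3 − β ^ 2 − β − 1# ≈ 0#) (fγ≈0 : γ ^ 3 − γ ^ 2 − γ − 1# ≈ 0#)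
    (α≉β : ¬ (α ≈ β)) (α≉γ : ¬ (α ≈ γ)) (β≉γ : ¬ (β ≈ γ)) where
    open FieldProperties F
    open IntegerCoefficients F
    open Tribonacci F α β γ using (c₁; c₂; c₃)
    open import Relation.Binary.Reasoning.Setoid setoid
    open import Algebra.Properties.CommutativeSemigroup *-commutativeSemigroup using (interchange)
    open import Data.Fin using (#_)
    open import Data.Vec.Base using (Vec; []; _∷_)
    open import Data.Vec.Relation.Binary.Pointwise.Inductive using ([]; _∷_)

    ρ : Vec Carrier 3
    ρ = α ∷ β ∷ γ ∷ []

    x y z : Polynomial 3
    x = var (# 0)
    y = var (# 1)
    z = var (# 2)

    κ : ∀ {n} → ℕ → Polynomial n
    κ k = con (k ⊖ 0)

    -1ᶻ : ∀ {n} → Polynomial n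
    -1ᶻ = con (0 ⊖ 1)

    cubic : Polynomial 3 → Polynomial 3
    cubic t = t :^ 3 :- t :^ 2 :- t :- κ 1

    -- (s − t) · cubicQuotient s t = cubic s − cubic t
    cubicQuotient : Polynomial 3 → Polynomial 3 → Polynomial 3
    cubicQuotient s t = s :^ 2 :+ s :* t :+ t :^ 2 :- s :- t :- κ 1

    e₁ e₂ e₃ : Polynomial 3
    e₁ = x :+ y :+ z
    e₂ = x :* y :+ y :* z :+ z :* x
    e₃ = x :* y :* z

    discriminant : ∀ {n} → Polynomial n → Polynomial n → Polynomial n → Polynomial n
    discriminant p q r = p :^ 2 :* q :^ 2 :- κ 4 :* q :^ 3 :- κ 4 :* p :^ 3 :* r :+ κ 18 :* p :* q :* r :- κ 27 :* r :^ 2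

    cubic≈0 : ∀ {t} → t ^ 3 − t ^ 2 − t − 1# ≈ 0# → t ^ 3 − t ^ 2 − t − ⟦ 1 ⊖ 0 ⟧ᵈ ≈ 0#
    cubic≈0 = trans (+-congˡ (-‿cong ⟦1⊖0⟧ᵈ≈1#))

    cubicQuotient-αβ≈0 : ⟦ cubicQuotient x y ⟧ᶻ ρ ≈ 0#
    cubicQuotient-αβ≈0 = cancel-difference α≉β (trans (byNormalisation ((x :- y) :* cubicQuotient x y) (cubic x :- cubic y) ρ)
      (−-zero (cubic≈0 fα≈0) (cubic≈0 fβ≈0)))

    cubicQuotient-αγ≈0 : ⟦ cubicQuotient x z ⟧ᶻ ρ ≈ 0#
    cubicQuotient-αγ≈0 = cancel-difference α≉γ (trans (byNormalisation ((x :- z) :* cubicQuotient x z) (cubic x :- cubic z) ρ)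
      (−-zero (cubic≈0 fα≈0) (cubic≈0 fγ≈0)))

    e₁-1≈0 : ⟦ e₁ :- κ 1 ⟧ᶻ ρ ≈ 0#
    e₁-1≈0 = cancel-difference β≉γ (trans (byNormalisation ((y :- z) :* (e₁ :- κ 1)) (cubicQuotient x y :- cubicQuotient x z) ρ)
      (−-zero cubicQuotient-αβ≈0 cubicQuotient-αγ≈0))

    e₂+1≈0 : ⟦ e₂ :- -1ᶻ ⟧ᶻ ρ ≈ 0#
    e₂+1≈0 = trans (byNormalisation (e₂ :- -1ᶻ) ((e₁ :- κ 1) :* (x :+ y) :- cubicQuotient x y) ρ)
      (−-zero (*-zeroˡ _ e₁-1≈0) cubicQuotient-αβ≈0)

    e₃-1≈0 : ⟦ e₃ :- κ 1 ⟧ᶻ ρ ≈ 0#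
    e₃-1≈0 = trans (byNormalisation (e₃ :- κ 1) (cubic x :- (e₁ :- κ 1) :* x :^ 2 :+ (e₂ :- -1ᶻ) :* x) ρ)
      (+-zero (−-zero (cubic≈0 fα≈0) (*-zeroˡ _ e₁-1≈0)) (*-zeroˡ _ e₂+1≈0))

    α+β+γ≈1 : α + β + γ ≈ 1#
    α+β+γ≈1 = trans (x−y≈0⇒x≈y _ _ e₁-1≈0) ⟦1⊖0⟧ᵈ≈1#

    αβγ≈1 : α * β * γ ≈ 1#
    αβγ≈1 = trans (x−y≈0⇒x≈y _ _ e₃-1≈0) ⟦1⊖0⟧ᵈ≈1#

    d₁ d₂ d₃ : Carrier
    d₁ = (α − β) * (α − γ)
    d₂ = (β − α) * (β − γ)
    d₃ = (γ − α) * (γ − β)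

    -- ∏_{i≠j}(rᵢ − rⱼ) is minus the discriminant of the cubic.
    d₁d₂d₃≈44 : d₁ * d₂ * d₃ ≈ ⟦ 44 ⟧
    d₁d₂d₃≈44 = begin
      ⟦ differences ⟧ᶻ ρ
        ≈⟨ byNormalisation differences (:- discriminant e₁ e₂ e₃) ρ ⟩
      ⟦ :- discriminant x y z ⟧ᶻ (⟦ e₁ ⟧ᶻ ρ ∷ ⟦ e₂ ⟧ᶻ ρ ∷ ⟦ e₃ ⟧ᶻ ρ ∷ [])
        ≈⟨ ⟦⟧-cong (:- discriminant x y z) (x−y≈0⇒x≈y _ _ e₁-1≈0 ∷ x−y≈0⇒x≈y _ _ e₂+1≈0 ∷ x−y≈0⇒x≈y _ _ e₃-1≈0 ∷ []) ⟩
      ⟦ :- discriminant (κ 1) -1ᶻ (κ 1) ⟧ᶻ []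
        ≈⟨ byNormalisation (:- discriminant (κ 1) -1ᶻ (κ 1)) (κ 44) [] ⟩
      ⟦ 44 ⊖ 0 ⟧ᵈ
        ≈⟨ ⟦k⊖0⟧ᵈ≈⟦k⟧ 44 ⟩
      ⟦ 44 ⟧ ∎
      where
      differences = (x :- y) :* (x :- z) :* ((y :- x) :* (y :- z)) :* ((z :- x) :* (z :- y))

    c₁c₂c₃*44≈1 : c₁ * c₂ * c₃ * ⟦ 44 ⟧ ≈ 1#
    c₁c₂c₃*44≈1 = begin
      c₁ * c₂ * c₃ * ⟦ 44 ⟧             ≈⟨ *-congˡ d₁d₂d₃≈44 ⟨
      c₁ * c₂ * c₃ * (d₁ * d₂ * d₃)     ≈⟨ interchange (c₁ * c₂) c₃ (d₁ * d₂) d₃ ⟩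
      c₁ * c₂ * (d₁ * d₂) * (c₃ * d₃)   ≈⟨ *-congʳ (interchange c₁ c₂ d₁ d₂) ⟩
      c₁ * d₁ * (c₂ * d₂) * (c₃ * d₃)   ≈⟨ *-cong (*-cong (÷-*-cancel α d₁≉0) (÷-*-cancel β d₂≉0)) (÷-*-cancel γ d₃≉0) ⟩
      α * β * γ                         ≈⟨ αβγ≈1 ⟩
      1#                                ∎
      where
      d₁≉0 = *-nonzero (x≉y⇒x−y≉0 α≉β) (x≉y⇒x−y≉0 α≉γ)
      d₂≉0 = *-nonzero (x≉y⇒x−y≉0 (λ β≈α → α≉β (sym β≈α))) (x≉y⇒x−y≉0 β≉γ)
      d₃≉0 = *-nonzero (x≉y⇒x−y≉0 (λ γ≈α → α≉γ (sym γ≈α))) (x≉y⇒x−y≉0 (λ γ≈β → β≉γ (sym γ≈β)))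

module Theorem9Proof {c ℓ} (F : Char0Field c ℓ) where
  open Char0Field F

  module Setting (α β γ : Carrier)
    (fα≈0 : α ^ 3 − α ^ 2 − α − 1# ≈ 0#) (fβ≈0 : β ^ 3 − β ^ 2 − β − 1# ≈ 0#) (fγ≈0 : γ ^ 3 − γ ^ 2 − γ − 1# ≈ 0#)
    (α≉β : ¬ (α ≈ β)) (α≉γ : ¬ (α ≈ γ)) (β≉γ : ¬ (β ≈ γ))
    (A s₀ s₁ s₂ : ℕ → Carrier)
    (A≉0 : ∀ N → 1 ≤ N → ¬ (A N ≈ 0#))
    (A⁻¹*T≈egfCoeff : ∀ N → 1 ≤ N → ∀ k → (A N) ⁻¹ * T (s₀ N) (s₁ N) (s₂ N) k ≈ Tribonacci.egfCoeff F α β γ N k)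
    (m n : ℕ) (1≤n : 1 ≤ n) where
    open Tribonacci F α β γ
    open FieldProperties F
    open BinomialConvolution F
    open ExponentialSums F
    open Sequences α β γ
    open TribonacciRoots.Roots F α β γ fα≈0 fβ≈0 fγ≈0 α≉β α≉γ β≉γ using (α+β+γ≈1; c₁c₂c₃*44≈1)
    open import Relation.Binary.Reasoning.Setoid setoid
    open import Algebra.Solver.Ring.NaturalCoefficients.Default commutativeSemiring
      using (solve; _:+_; _:*_; _:=_; con) renaming (⟦_⟧ to ⟦_⟧ₚ)
    open import Algebra.Properties.Semiring.Exp semiring using (^-congˡ; ^-assocʳ)
    open import Algebra.Properties.CommutativeSemiring.Exp commutativeSemiring using (^-distrib-*)
    open import Algebra.Properties.Semiring.Mult.TCOptimised semiring using (×ᵤ≈×)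
    open import Algebra.Properties.Ring ring using (-‿distribˡ-*)
    open import Algebra.Properties.CommutativeSemigroup *-commutativeSemigroup using (x∙yz≈y∙xz)
    open import Data.Vec.Base using (Vec; []; _∷_)

    trib : ℕ → ℕ → Carrier
    trib N = T (s₀ N) (s₁ N) (s₂ N)

    trib≈A*egfCoeff : ∀ N → 1 ≤ N → ∀ k → trib N k ≈ A N * egfCoeff N k
    trib≈A*egfCoeff N 1≤N k = begin
      trib N k                       ≈⟨ *-identityˡ _ ⟨
      1# * trib N k                  ≈⟨ *-congʳ (⁻¹-inverse (A N) (A≉0 N 1≤N)) ⟨
      A N * A N ⁻¹ * trib N k        ≈⟨ *-assoc _ _ _ ⟩
      A N * (A N ⁻¹ * trib N k)      ≈⟨ *-congˡ (A⁻¹*T≈egfCoeff N 1≤N k) ⟩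
      A N * egfCoeff N k             ∎

    1≤jn : ∀ j → 1 ≤ suc j *ℕ n
    1≤jn j = ℕ.≤-trans 1≤n (ℕ.m≤n*m n (suc j))

    A≉0ₙ : ¬ (A n ≈ 0#)
    A≉0ₙ = A≉0 n 1≤n

    X : ℕ → ℕ → ℕ → Carrier
    X a b d = rate a b d ^ m

    -- Exponentials in the order fixed by degree4Var.
    ρ : Vec Carrier 18
    ρ = c₁ ^ n ∷ c₂ ^ n ∷ c₃ ^ n ∷ X 4 0 0 ∷ X 0 4 0 ∷ X 0 0 4 ∷ X 3 1 0 ∷ X 3 0 1 ∷ X 1 3 0 ∷ X 0 3 1
      ∷ X 1 0 3 ∷ X 0 1 3 ∷ X 2 2 0 ∷ X 2 0 2 ∷ X 0 2 2 ∷ X 2 1 1 ∷ X 1 2 1 ∷ X 1 1 2 ∷ []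

    open At ρ public using (toSeq; ⋆-toSeq)

    p₁ : ExpSum
    p₁ = powerSum 1

    ⟦con⟧≈ : ∀ k → ⟦ con k ⟧ₚ ρ ≈ ⟦ k ⟧
    ⟦con⟧≈ k = sym (×ᵤ≈× k 1#)

    -- On lists homogeneous of degree 4, ⟦ toPoly L ⟧ₚ ρ reduces to toSeq L m.
    powerSumIdentityₘ : toSeq (p₁ ⊗ p₁ ⊗ p₁ ⊗ p₁) m + ⟦ 6 ⟧ * toSeq (powerSum 4) m
      ≈ ⟦ 4 ⟧ * toSeq (powerSum 3 ⊗ p₁) m + ⟦ 3 ⟧ * toSeq (powerSum 2 ⊗ powerSum 2) m + ⟦ 12 ⟧ * toSeq (p₁ ⊗ x₁x₂x₃) m
    powerSumIdentityₘ = begin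
      _ ≈⟨ +-congˡ (*-congʳ (⟦con⟧≈ 6)) ⟨
      _ ≈⟨ powerSumIdentity ρ ⟩
      _ ≈⟨ +-cong (+-cong (*-congʳ (⟦con⟧≈ 4)) (*-congʳ (⟦con⟧≈ 3))) (*-congʳ (⟦con⟧≈ 12)) ⟩
      _ ∎

    dilate-egfCoeff≈powerSum : ∀ j k → dilate j (egfCoeff (j *ℕ n)) k ≈ toSeq (powerSum j) k
    dilate-egfCoeff≈powerSum j k = begin
      J * (c₁ ^ (j *ℕ n) * α ^ k + c₂ ^ (j *ℕ n) * β ^ k + c₃ ^ (j *ℕ n) * γ ^ k)
        ≈⟨ solve 4 (λ J a b d → J :* (a :+ b :+ d) := J :* a :+ J :* b :+ J :* d) refl J _ _ _ ⟩
      J * (c₁ ^ (j *ℕ n) * α ^ k) + J * (c₂ ^ (j *ℕ n) * β ^ k) + J * (c₃ ^ (j *ℕ n) * γ ^ k)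
        ≈⟨ +-cong (+-cong (summand c₁ α (trans (+-identityʳ _) (+-identityʳ _)))
                          (summand c₂ β (trans (+-identityʳ _) (+-identityˡ _))))
                  (summand c₃ γ (trans (+-congʳ (+-identityʳ 0#)) (+-identityˡ _))) ⟩
      (c₁ ^ n) ^ j * rate j 0 0 ^ k + (c₂ ^ n) ^ j * rate 0 j 0 ^ k + (c₃ ^ n) ^ j * rate 0 0 j ^ k
        ≈⟨ solve 3 (λ a b d → a :+ b :+ d := a :+ (b :+ (d :+ con 0))) refl _ _ _ ⟩
      toSeq (powerSum j) k ∎
      where
      J = ⟦ j ^ℕ k ⟧
      summand : ∀ cᵢ r {s} → s ≈ j × r → J * (cᵢ ^ (j *ℕ n) * r ^ k) ≈ (cᵢ ^ n) ^ j * s ^ k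
      summand cᵢ r s≈j×r = begin
        J * (cᵢ ^ (j *ℕ n) * r ^ k)  ≈⟨ x∙yz≈y∙xz J _ _ ⟩
        cᵢ ^ (j *ℕ n) * (J * r ^ k)  ≈⟨ *-cong (reflexive (≡.cong (cᵢ ^_) (ℕ.*-comm j n))) (⟦j^k⟧*x^k≈[j×x]^k j k r) ⟩
        cᵢ ^ (n *ℕ j) * (j × r) ^ k  ≈⟨ *-cong (sym (^-assocʳ cᵢ n j)) (^-congˡ k (sym s≈j×r)) ⟩
        (cᵢ ^ n) ^ j * _ ^ k         ∎

    egfCoeff≈toSeq-p₁ : ∀ k → egfCoeff n k ≈ toSeq p₁ k
    egfCoeff≈toSeq-p₁ k = begin
      egfCoeff n k                    ≈⟨ *-identityˡ _ ⟨
      1# * egfCoeff n k               ≈⟨ *-cong ⟦1^k⟧≈1 (reflexive (≡.cong (λ N → egfCoeff N k) (ℕ.*-identityˡ n))) ⟨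
      dilate 1 (egfCoeff (1 *ℕ n)) k  ≈⟨ dilate-egfCoeff≈powerSum 1 k ⟩
      toSeq p₁ k                      ∎
      where
      ⟦1^k⟧≈1 : ⟦ 1 ^ℕ k ⟧ ≈ 1#
      ⟦1^k⟧≈1 = trans (reflexive (≡.cong ⟦_⟧ (ℕ.^-zeroˡ k))) (+-identityʳ 1#)

    U : ℕ → Carrier
    U = trib n

    U≈Aₙ*egfCoeff : ∀ k → U k ≈ A n * egfCoeff n k
    U≈Aₙ*egfCoeff = trib≈A*egfCoeff n 1≤n

    toSeq-⋆⁴ : ∀ L m → (toSeq L ⋆ toSeq L ⋆ toSeq L ⋆ toSeq L) m ≈ toSeq (L ⊗ L ⊗ L ⊗ L) m
    toSeq-⋆⁴ L m = trans (⋆-cong (λ _ → refl) (λ j → trans (⋆-cong (λ _ → refl) (⋆-toSeq L L) j) (⋆-toSeq L (L ⊗ L) j)) m)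
                         (⋆-toSeq L (L ⊗ L ⊗ L) m)

    multinomialSum≈ : (A n ^ 4) ⁻¹ * sum4 m (λ k₁ k₂ k₃ k₄ → ⟦ multinomial4 m k₁ k₂ k₃ k₄ ⟧ * U k₁ * U k₂ * U k₃ * U k₄)
                        ≈ toSeq (p₁ ⊗ p₁ ⊗ p₁ ⊗ p₁) m
    multinomialSum≈ = begin
      (A n ^ 4) ⁻¹ * sum4 m (λ k₁ k₂ k₃ k₄ → ⟦ multinomial4 m k₁ k₂ k₃ k₄ ⟧ * U k₁ * U k₂ * U k₃ * U k₄)
        ≈⟨ *-congˡ (multinomial-⋆ U m) ⟩
      (A n ^ 4) ⁻¹ * (U ⋆ U ⋆ U ⋆ U) m
        ≈⟨ *-congˡ (⋆⁴-scaled U≈Aₙ*egfCoeff m) ⟩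
      (A n ^ 4) ⁻¹ * (A n ^ 4 * (u ⋆ u ⋆ u ⋆ u) m)
        ≈⟨ ⁻¹-cancelˡ _ (^-nonzero A≉0ₙ 4) ⟩
      (u ⋆ u ⋆ u ⋆ u) m
        ≈⟨ ⋆-cong egfCoeff≈toSeq-p₁ (⋆-cong egfCoeff≈toSeq-p₁ (⋆-cong egfCoeff≈toSeq-p₁ egfCoeff≈toSeq-p₁)) m ⟩
      (toSeq p₁ ⋆ toSeq p₁ ⋆ toSeq p₁ ⋆ toSeq p₁) m
        ≈⟨ toSeq-⋆⁴ p₁ m ⟩
      toSeq (p₁ ⊗ p₁ ⊗ p₁ ⊗ p₁) m ∎
      where u = egfCoeff n

    V₄-term≈ : - (⟦ 6 *ℕ (4 ^ℕ m) ⟧ ÷ A (4 *ℕ n)) * trib (4 *ℕ n) m ≈ - (⟦ 6 ⟧ * toSeq (powerSum 4) m)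
    V₄-term≈ = begin
      - (⟦ 6 *ℕ (4 ^ℕ m) ⟧ ÷ A₄) * trib (4 *ℕ n) m       ≈⟨ -‿distribˡ-* _ _ ⟨
      - ((⟦ 6 *ℕ (4 ^ℕ m) ⟧ ÷ A₄) * trib (4 *ℕ n) m)     ≈⟨ -‿cong (*-congˡ (trib≈A*egfCoeff _ (1≤jn 3) m)) ⟩
      - ((⟦ 6 *ℕ (4 ^ℕ m) ⟧ ÷ A₄) * (A₄ * e₄ m))         ≈⟨ -‿cong (÷-cancel _ _ (A≉0 _ (1≤jn 3))) ⟩
      - (⟦ 6 *ℕ (4 ^ℕ m) ⟧ * e₄ m)                       ≈⟨ -‿cong (trans (*-congʳ (⟦⟧-homo-* 6 (4 ^ℕ m))) (*-assoc _ _ _)) ⟩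
      - (⟦ 6 ⟧ * dilate 4 e₄ m)                          ≈⟨ -‿cong (*-congˡ (dilate-egfCoeff≈powerSum 4 m)) ⟩
      - (⟦ 6 ⟧ * toSeq (powerSum 4) m)                   ∎
      where
      A₄ = A (4 *ℕ n)
      e₄ = egfCoeff (4 *ℕ n)

    V₃-term≈ : (⟦ 4 ⟧ ÷ (A (3 *ℕ n) * A n)) * sumTo m (λ k → ⟦ m C k ⟧ * ⟦ 3 ^ℕ k ⟧ * trib (3 *ℕ n) k * U (m ∸ k))
                 ≈ ⟦ 4 ⟧ * toSeq (powerSum 3 ⊗ p₁) m
    V₃-term≈ = begin
      (⟦ 4 ⟧ ÷ (A₃ * A n)) * sumTo m (λ k → ⟦ m C k ⟧ * ⟦ 3 ^ℕ k ⟧ * trib (3 *ℕ n) k * U (m ∸ k))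
        ≈⟨ *-congˡ (sumTo-cong m (λ k _ → *-congʳ (*-assoc _ _ _))) ⟩
      (⟦ 4 ⟧ ÷ (A₃ * A n)) * (dilate 3 (trib (3 *ℕ n)) ⋆ U) m
        ≈⟨ *-congˡ (⋆-cong-scaled (dilate-scaled 3 (trib≈A*egfCoeff _ (1≤jn 2))) U≈Aₙ*egfCoeff m) ⟩
      (⟦ 4 ⟧ ÷ (A₃ * A n)) * ((A₃ * A n) * (dilate 3 e₃ ⋆ egfCoeff n) m)
        ≈⟨ ÷-cancel _ _ (*-nonzero (A≉0 _ (1≤jn 2)) A≉0ₙ) ⟩
      ⟦ 4 ⟧ * (dilate 3 e₃ ⋆ egfCoeff n) m
        ≈⟨ *-congˡ (trans (⋆-cong (dilate-egfCoeff≈powerSum 3) egfCoeff≈toSeq-p₁ m) (⋆-toSeq (powerSum 3) p₁ m)) ⟩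
      ⟦ 4 ⟧ * toSeq (powerSum 3 ⊗ p₁) m ∎
      where
      A₃ = A (3 *ℕ n)
      e₃ = egfCoeff (3 *ℕ n)

    V₂-term≈ : (⟦ 3 ⟧ ÷ (A (2 *ℕ n) ^ 2)) * sumTo m (λ k → ⟦ m C k ⟧ * ⟦ 2 ^ℕ m ⟧ * trib (2 *ℕ n) k * trib (2 *ℕ n) (m ∸ k))
                 ≈ ⟦ 3 ⟧ * toSeq (powerSum 2 ⊗ powerSum 2) m
    V₂-term≈ = begin
      (⟦ 3 ⟧ ÷ (A₂ ^ 2)) * sumTo m (λ k → ⟦ m C k ⟧ * ⟦ 2 ^ℕ m ⟧ * V k * V (m ∸ k))
        ≈⟨ *-congˡ (sumTo-cong m (λ k _ → solve 4 (λ b t x y → b :* t :* x :* y := t :* (b :* x :* y)) refl _ _ _ _)) ⟩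
      (⟦ 3 ⟧ ÷ (A₂ ^ 2)) * sumTo m (λ k → ⟦ 2 ^ℕ m ⟧ * (⟦ m C k ⟧ * V k * V (m ∸ k)))
        ≈⟨ *-congˡ (sumTo-*ˡ m _ _) ⟨
      (⟦ 3 ⟧ ÷ (A₂ ^ 2)) * dilate 2 (V ⋆ V) m
        ≈⟨ *-congˡ (dilate-⋆ 2 V V m) ⟩
      (⟦ 3 ⟧ ÷ (A₂ ^ 2)) * (dilate 2 V ⋆ dilate 2 V) m
        ≈⟨ *-congˡ (⋆-cong-scaled V≈A₂e₂ V≈A₂e₂ m) ⟩
      (⟦ 3 ⟧ ÷ (A₂ ^ 2)) * ((A₂ * A₂) * (dilate 2 e₂ ⋆ dilate 2 e₂) m)
        ≈⟨ *-congˡ (*-congʳ (*-congˡ (*-identityʳ A₂))) ⟨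
      (⟦ 3 ⟧ ÷ (A₂ ^ 2)) * (A₂ ^ 2 * (dilate 2 e₂ ⋆ dilate 2 e₂) m)
        ≈⟨ ÷-cancel _ _ (^-nonzero (A≉0 _ (1≤jn 1)) 2) ⟩
      ⟦ 3 ⟧ * (dilate 2 e₂ ⋆ dilate 2 e₂) m
        ≈⟨ *-congˡ (trans (⋆-cong (dilate-egfCoeff≈powerSum 2) (dilate-egfCoeff≈powerSum 2) m) (⋆-toSeq (powerSum 2) (powerSum 2) m)) ⟩
      ⟦ 3 ⟧ * toSeq (powerSum 2 ⊗ powerSum 2) m ∎
      where
      A₂ = A (2 *ℕ n)
      V = trib (2 *ℕ n)
      e₂ = egfCoeff (2 *ℕ n)
      V≈A₂e₂ = dilate-scaled 2 (trib≈A*egfCoeff _ (1≤jn 1))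

    44ⁿ*c₁ⁿc₂ⁿc₃ⁿ≈1 : ⟦ 44 ^ℕ n ⟧ * (c₁ ^ n * c₂ ^ n * c₃ ^ n) ≈ 1#
    44ⁿ*c₁ⁿc₂ⁿc₃ⁿ≈1 = begin
      ⟦ 44 ^ℕ n ⟧ * (c₁ ^ n * c₂ ^ n * c₃ ^ n)  ≈⟨ *-comm _ _ ⟩
      c₁ ^ n * c₂ ^ n * c₃ ^ n * ⟦ 44 ^ℕ n ⟧   ≈⟨ *-cong (sym (trans (^-distrib-* (c₁ * c₂) c₃ n) (*-congʳ (^-distrib-* c₁ c₂ n)))) (⟦⟧-homo-^ 44 n) ⟩
      (c₁ * c₂ * c₃) ^ n * ⟦ 44 ⟧ ^ n           ≈⟨ ^-distrib-* _ _ n ⟨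
      (c₁ * c₂ * c₃ * ⟦ 44 ⟧) ^ n               ≈⟨ ^-congˡ n c₁c₂c₃*44≈1 ⟩
      1# ^ n                                   ≈⟨ 1#^k≈1# n ⟩
      1#                                       ∎

    U-term≈ : (⟦ 12 ⟧ ÷ (⟦ 44 ^ℕ n ⟧ * A n)) * sumTo m (λ k → ⟦ m C k ⟧ * U k) ≈ ⟦ 12 ⟧ * toSeq (p₁ ⊗ x₁x₂x₃) m
    U-term≈ = begin
      (⟦ 12 ⟧ ÷ (⟦ 44 ^ℕ n ⟧ * A n)) * sumTo m (λ k → ⟦ m C k ⟧ * U k)
        ≈⟨ *-congˡ (sumTo-cong m (λ k _ → *-identityʳ _)) ⟨
      (⟦ 12 ⟧ ÷ (⟦ 44 ^ℕ n ⟧ * A n)) * (U ⋆ one) m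
        ≈⟨ *-congˡ (trans (⋆-cong {g = one} U≈Aₙ*egfCoeff (λ _ → refl) m) (*-⋆-assocˡ (A n) u one m)) ⟩
      (⟦ 12 ⟧ ÷ (⟦ 44 ^ℕ n ⟧ * A n)) * (A n * (u ⋆ one) m)
        ≈⟨ solve 4 (λ a b c d → a :* b :* (c :* d) := a :* (b :* c :* d)) refl ⟦ 12 ⟧ _ (A n) _ ⟩
      ⟦ 12 ⟧ * ((⟦ 44 ^ℕ n ⟧ * A n) ⁻¹ * A n * (u ⋆ one) m)
        ≈⟨ *-congˡ (*-congʳ (⁻¹-*-cancelʳ 44ⁿ*c₁ⁿc₂ⁿc₃ⁿ≈1 A≉0ₙ)) ⟩
      ⟦ 12 ⟧ * (W * (u ⋆ one) m)
        ≈⟨ *-congˡ (*-⋆-assocʳ W u one m) ⟨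
      ⟦ 12 ⟧ * (u ⋆ (λ _ → W * 1#)) m
        ≈⟨ *-congˡ (trans (⋆-cong egfCoeff≈toSeq-p₁ W≈toSeq-x₁x₂x₃ m) (⋆-toSeq p₁ x₁x₂x₃ m)) ⟩
      ⟦ 12 ⟧ * toSeq (p₁ ⊗ x₁x₂x₃) m ∎
      where
      u = egfCoeff n
      one : ℕ → Carrier
      one _ = 1#
      W = c₁ ^ n * c₂ ^ n * c₃ ^ n
      W≈toSeq-x₁x₂x₃ : ∀ k → W * 1# ≈ toSeq x₁x₂x₃ k
      W≈toSeq-x₁x₂x₃ k = sym (trans (+-identityʳ _) (*-congˡ (trans (^-congˡ k rate111≈1) (1#^k≈1# k))))
        where
        rate111≈1 : rate 1 1 1 ≈ 1#
        rate111≈1 = trans (+-cong (+-cong (+-identityʳ α) (+-identityʳ β)) (+-identityʳ γ)) α+β+γ≈1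

theorem9 : ∀ {c ℓ} (F : Char0Field c ℓ) → let open Char0Field F in
  (α β γ : Carrier) →
  (α ^ 3 − α ^ 2 − α − 1# ≈ 0#) → (β ^ 3 − β ^ 2 − β − 1# ≈ 0#) → (γ ^ 3 − γ ^ 2 − γ − 1# ≈ 0#) →
  ¬ (α ≈ β) → ¬ (α ≈ γ) → ¬ (β ≈ γ) →
  let open Tribonacci F α β γ in
  (A s₀ s₁ s₂ : ℕ → Carrier) →
  (∀ N → 1 ≤ N → ¬ (A N ≈ 0#)) →
  (∀ N → 1 ≤ N → ∀ k → (A N) ⁻¹ * T (s₀ N) (s₁ N) (s₂ N) k ≈ egfCoeff N k) →
  ∀ (m n : ℕ) → 1 ≤ n →
  let U = T (s₀ n) (s₁ n) (s₂ n)
      V2 = T (s₀ (2 *ℕ n)) (s₁ (2 *ℕ n)) (s₂ (2 *ℕ n))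
      V3 = T (s₀ (3 *ℕ n)) (s₁ (3 *ℕ n)) (s₂ (3 *ℕ n))
      V4 = T (s₀ (4 *ℕ n)) (s₁ (4 *ℕ n)) (s₂ (4 *ℕ n))
  in
  ((A n) ^ 4) ⁻¹ * sum4 m (λ k₁ k₂ k₃ k₄ → ⟦ multinomial4 m k₁ k₂ k₃ k₄ ⟧ * U k₁ * U k₂ * U k₃ * U k₄)
    ≈ - (⟦ 6 *ℕ (4 ^ℕ m) ⟧ ÷ A (4 *ℕ n)) * V4 m
      + (⟦ 4 ⟧ ÷ (A (3 *ℕ n) * A n)) * sumTo m (λ k → ⟦ m C k ⟧ * ⟦ 3 ^ℕ k ⟧ * V3 k * U (m ∸ k))
      + (⟦ 3 ⟧ ÷ (A (2 *ℕ n) ^ 2)) * sumTo m (λ k → ⟦ m C k ⟧ * ⟦ 2 ^ℕ m ⟧ * V2 k * V2 (m ∸ k))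
      + (⟦ 12 ⟧ ÷ (⟦ 44 ^ℕ n ⟧ * A n)) * sumTo m (λ k → ⟦ m C k ⟧ * U k)
theorem9 F α β γ fα≈0 fβ≈0 fγ≈0 α≉β α≉γ β≉γ A s₀ s₁ s₂ A≉0 A⁻¹*T≈egfCoeff m n 1≤n = begin
  _                                       ≈⟨ multinomialSum≈ ⟩
  toSeq (p₁ ⊗ p₁ ⊗ p₁ ⊗ p₁) m             ≈⟨ x+t≈p+q+r⇒x≈-t+p+q+r powerSumIdentityₘ ⟩
  - (⟦ 6 ⟧ * toSeq (powerSum 4) m) + ⟦ 4 ⟧ * toSeq (powerSum 3 ⊗ p₁) m
    + ⟦ 3 ⟧ * toSeq (powerSum 2 ⊗ powerSum 2) m + ⟦ 12 ⟧ * toSeq (p₁ ⊗ x₁x₂x₃) m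
                                          ≈⟨ +-cong (+-cong (+-cong V₄-term≈ V₃-term≈) V₂-term≈) U-term≈ ⟨
  _                                       ∎
  where
  open Char0Field F
  open FieldProperties F using (x+t≈p+q+r⇒x≈-t+p+q+r)
  open ExponentialSums F using (_⊗_; powerSum; x₁x₂x₃)
  open Theorem9Proof.Setting F α β γ fα≈0 fβ≈0 fγ≈0 α≉β α≉γ β≉γ A s₀ s₁ s₂ A≉0 A⁻¹*T≈egfCoeff m n 1≤n
  open import Relation.Binary.Reasoning.Setoid setoid
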